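{- Let $p$ be an odd prime, $\varepsilon\in\{ -1,1\}$ and $z\in\mathbb{Z}$ with $\gcd(p,z(z+1))=1$. Then for all $r\in\mathbb{N}$, \[ \sum_{k=0}^{p-1}(2k+1)^{2r+1}\varepsilon^k S_k(z)\equiv 1\pmod{p} \quad\text{and}\quad \sum_{k=0}^{p-1}(2k+1)^{2r+1}\varepsilon^k s_k(z)\equiv 0\pmod{p}. \]
   Context: $\mathbb{N}=\{0,1,2,\dots\}$. The large Schröder polynomials are $S_n(z)=\sum_{k=0}^{n}\binom{n}{k}\binom{n+k}{k}\frac{1}{k+1}z^k$ for $n\in\mathbb{N}$, and the little Schröder polynomials are $s_0(z)=0$ and $s_n(z)=\sum_{k=1}^{n}\frac{1}{n}\binom{n}{k}\binom{n}{k-1}z^{k-1}(z+1)^{n-k}$ for $n\ge 1$. -}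

module Defs where

open import Data.Nat as ℕ using (ℕ; zero; suc; _∸_)
open import Data.Nat.DivMod using (_/_)
open import Data.Nat.Combinatorics using (_C_)
open import Data.Integer as ℤ using (ℤ; +_; _+_; _*_; _^_)

Σ< : ℕ → (ℕ → ℤ) → ℤ
Σ< zero    f = + 0
Σ< (suc n) f = Σ< n f + f n

-- large Schröder polynomial S_n(z) = Σ_{k=0}^{n} C(n,k) C(n+k,k) / (k+1) z^k
-- (the coefficient is an integer, so exact ℕ-division is used)
largeS : ℕ → ℤ → ℤ
largeS n z = Σ< (suc n) (λ k → + (((n C k) ℕ.* ((n ℕ.+ k) C k)) / suc k) * z ^ k)

-- little Schröder polynomial: s_0 = 0,
-- s_n(z) = Σ_{k=1}^{n} (1/n) C(n,k) C(n,k-1) z^(k-1) (z+1)^(n-k)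
-- (index shifted: k = j+1 with j = 0..n-1; coefficients are Narayana numbers, integers)
littleS : ℕ → ℤ → ℤ
littleS zero    z = + 0
littleS (suc m) z = Σ< (suc m) (λ j →
  + (((suc m C suc j) ℕ.* (suc m C j)) / suc m) * (z ^ j * (z + + 1) ^ (m ∸ j)))

module Submission where

-- For k < p write S_k(z) = Σ_j c(k,j) zʲ with c(k,j) = C(k,j) C(k+j,j) / (j+1).  Since
-- C(a,j) ≡ (-1)ʲ C(b+j,j) (mod p) whenever a + b + 1 ≡ 0, the coefficients satisfy
-- c(k,j) ≡ c(p-1-k,j) for j < p-1, while 2k+1 ↦ -(2k+1) and εᵏ ↦ εᵏ under k ↦ p-1-k.  Hence the
-- part of Σ_k (2k+1)^(2r+1) εᵏ S_k(z) carried by the powers zʲ, j < p-1, is odd under this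
-- reflection and vanishes (p is odd).  The power z^(p-1) occurs only for k = p-1, with coefficient
-- the Catalan number c(p-1,p-1) ≡ -1; together with z^(p-1) ≡ 1, (2p-1)^(2r+1) ≡ -1 and
-- ε^(p-1) = 1 this leaves 1.  Finally S_k = (z+1) s_k for k ≥ 1, by comparing coefficients with
-- Vandermonde's identity, so the first sum is 1 + (z+1) times the second, and z+1 is invertible.

module BinomialCoefficients where

  open import Data.Nat using (ℕ; zero; suc; _+_; _*_; _∸_; _≤_; _<_; NonZero)
  open import Data.Nat.Properties
  open import Data.Nat.DivMod using (_/_; m*[n/m]≡n; 0/n≡0)
  open import Data.Nat.Divisibility using (_∣_; divides; ∣m+n∣m⇒∣n; m∣m*n; 1∣_; _∣0)
  open import Data.Nat.Combinatorics
    using (_C_; nCk+nC[k+1]≡[n+1]C[k+1]; nC1≡n; nCn≡1; nCk≡nC[n∸k]; k>n⇒nCk≡0)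
  open import Data.Nat.Tactic.RingSolver using (solve-∀)
  import Algebra.Properties.CommutativeSemigroup *-commutativeSemigroup as *-CS
  open import Relation.Binary.PropositionalEquality
  open ≡-Reasoning

  pascal : ∀ n k → suc n C suc k ≡ n C k + n C suc k
  pascal n k = sym (nCk+nC[k+1]≡[n+1]C[k+1] n k)

  [1+k]*[1+n]C[1+k]≡[1+n]*nCk : ∀ n k → suc k * (suc n C suc k) ≡ suc n * (n C k)
  [1+k]*[1+n]C[1+k]≡[1+n]*nCk zero    zero    = refl
  [1+k]*[1+n]C[1+k]≡[1+n]*nCk zero    (suc k) = *-zeroʳ (suc (suc k))
  [1+k]*[1+n]C[1+k]≡[1+n]*nCk (suc n) zero    =
    trans (*-identityˡ _) (trans (nC1≡n (suc (suc n))) (sym (*-identityʳ _)))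
  [1+k]*[1+n]C[1+k]≡[1+n]*nCk (suc n) (suc k) = begin
    suc (suc k) * (suc (suc n) C suc (suc k))  ≡⟨ cong (suc (suc k) *_) (pascal (suc n) (suc k)) ⟩
    suc (suc k) * (X + Y)                      ≡⟨ *-distribˡ-+ (suc (suc k)) X Y ⟩
    X + suc k * X + suc (suc k) * Y            ≡⟨ cong₂ (λ s t → X + s + t)
                                                        ([1+k]*[1+n]C[1+k]≡[1+n]*nCk n k)
                                                        ([1+k]*[1+n]C[1+k]≡[1+n]*nCk n (suc k)) ⟩
    X + suc n * a + suc n * b                  ≡⟨ regroup X (suc n) a b ⟩
    X + suc n * (a + b)                        ≡⟨ cong (λ t → X + suc n * t) (pascal n k) ⟨
    suc (suc n) * X                            ∎
    where
    a b X Y : ℕ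
    a = n C k
    b = n C suc k
    X = suc n C suc k
    Y = suc n C suc (suc k)
    regroup : ∀ x m a b → x + m * a + m * b ≡ x + m * (a + b)
    regroup = solve-∀

  [1+k]*nC[1+k]+[1+k]*nCk≡[1+n]*nCk : ∀ n k → suc k * (n C suc k) + suc k * (n C k) ≡ suc n * (n C k)
  [1+k]*nC[1+k]+[1+k]*nCk≡[1+n]*nCk n k = begin
    suc k * (n C suc k) + suc k * (n C k) ≡⟨ *-distribˡ-+ (suc k) (n C suc k) (n C k) ⟨
    suc k * (n C suc k + n C k)
      ≡⟨ cong (suc k *_) (trans (+-comm (n C suc k) (n C k)) (sym (pascal n k))) ⟩
    suc k * (suc n C suc k)               ≡⟨ [1+k]*[1+n]C[1+k]≡[1+n]*nCk n k ⟩
    suc n * (n C k)                       ∎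

  [1+k]*[n+k]C[1+k]≡n*[n+k]Ck : ∀ n k → suc k * ((n + k) C suc k) ≡ n * ((n + k) C k)
  [1+k]*[n+k]C[1+k]≡n*[n+k]Ck n k = +-cancelʳ-≡ _ _ _ (begin
    suc k * ((n + k) C suc k) + suc k * ((n + k) C k) ≡⟨ [1+k]*nC[1+k]+[1+k]*nCk≡[1+n]*nCk (n + k) k ⟩
    suc (n + k) * ((n + k) C k)                       ≡⟨ cong (_* ((n + k) C k)) (+-suc n k) ⟨
    (n + suc k) * ((n + k) C k)                       ≡⟨ *-distribʳ-+ ((n + k) C k) n (suc k) ⟩
    n * ((n + k) C k) + suc k * ((n + k) C k)         ∎)

  n∣nC[1+j]*nCj : ∀ n .{{_ : NonZero n}} j → n ∣ (n C suc j) * (n C j)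
  n∣nC[1+j]*nCj (suc n) j =
    ∣m+n∣m⇒∣n (divides (a * (u + v)) (trans key (*-comm m (a * (u + v))))) (m∣m*n (u * v))
    where
    m u v a : ℕ
    m = suc n
    u = m C suc j
    v = m C j
    a = n C j
    key : m * (u * v) + u * v ≡ m * (a * (u + v))
    key = begin
      m * (u * v) + u * v             ≡⟨ ring₁ m u v ⟩
      (suc m * v) * u                 ≡⟨ cong (_* u) ([1+k]*nC[1+k]+[1+k]*nCk≡[1+n]*nCk m j) ⟨
      (suc j * u + suc j * v) * u     ≡⟨ ring₂ (suc j) u v ⟩
      (suc j * u) * (u + v)           ≡⟨ cong (_* (u + v)) ([1+k]*[1+n]C[1+k]≡[1+n]*nCk n j) ⟩
      (m * a) * (u + v)               ≡⟨ *-assoc m a (u + v) ⟩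
      m * (a * (u + v))               ∎
      where
      ring₁ : ∀ m u v → m * (u * v) + u * v ≡ (suc m * v) * u
      ring₁ = solve-∀
      ring₂ : ∀ s u v → (s * u + s * v) * u ≡ (s * u) * (u + v)
      ring₂ = solve-∀

  [1+k]∣nCk*[n+k]Ck : ∀ n k → suc k ∣ (n C k) * ((n + k) C k)
  [1+k]∣nCk*[n+k]Ck n       zero    = 1∣ _
  [1+k]∣nCk*[n+k]Ck zero    (suc k) = _ ∣0
  [1+k]∣nCk*[n+k]Ck (suc m) (suc i) =
    ∣m+n∣m⇒∣n (subst (suc j ∣_) (+-comm P (j * P)) (m∣m*n P)) (divides (a * ((n + j) C suc j)) key)
    where
    n j a P : ℕ
    n = suc m
    j = suc i
    a = m C i
    P = (n C j) * ((n + j) C j)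
    key : j * P ≡ a * ((n + j) C suc j) * suc j
    key = begin
      j * ((n C j) * ((n + j) C j))      ≡⟨ *-assoc j (n C j) _ ⟨
      (j * (n C j)) * ((n + j) C j)      ≡⟨ cong (_* ((n + j) C j)) ([1+k]*[1+n]C[1+k]≡[1+n]*nCk m i) ⟩
      (n * a) * ((n + j) C j)            ≡⟨ *-CS.xy∙z≈y∙xz n a ((n + j) C j) ⟩
      a * (n * ((n + j) C j))            ≡⟨ cong (a *_) ([1+k]*[n+k]C[1+k]≡n*[n+k]Ck n j) ⟨
      a * (suc j * ((n + j) C suc j))    ≡⟨ *-CS.x∙yz≈xz∙y a (suc j) ((n + j) C suc j) ⟩
      a * ((n + j) C suc j) * suc j      ∎

  -- shiftedC j e k is the coefficient of zᵏ in zʲ (z + 1)ᵉ, that is C(e, k - j) for k ≥ j.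
  shiftedC : ℕ → ℕ → ℕ → ℕ
  shiftedC zero    e k       = e C k
  shiftedC (suc j) e zero    = 0
  shiftedC (suc j) e (suc k) = shiftedC j e k

  trinomial-revision : ∀ j e k → ((j + e) C j) * shiftedC j e k ≡ ((j + e) C k) * (k C j)
  trinomial-revision zero    e k       = trans (*-identityˡ (e C k)) (sym (*-identityʳ (e C k)))
  trinomial-revision (suc j) e zero    = *-zeroʳ (suc (j + e) C suc j)
  trinomial-revision (suc j) e (suc k) = *-cancelˡ-≡ _ _ (suc j) (begin
    suc j * ((suc n C suc j) * E)           ≡⟨ *-assoc (suc j) (suc n C suc j) E ⟨
    (suc j * (suc n C suc j)) * E           ≡⟨ cong (_* E) ([1+k]*[1+n]C[1+k]≡[1+n]*nCk n j) ⟩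
    (suc n * (n C j)) * E                   ≡⟨ *-assoc (suc n) (n C j) E ⟩
    suc n * ((n C j) * E)                   ≡⟨ cong (suc n *_) (trinomial-revision j e k) ⟩
    suc n * ((n C k) * (k C j))             ≡⟨ *-assoc (suc n) (n C k) (k C j) ⟨
    (suc n * (n C k)) * (k C j)             ≡⟨ cong (_* (k C j)) ([1+k]*[1+n]C[1+k]≡[1+n]*nCk n k) ⟨
    (suc k * (suc n C suc k)) * (k C j)     ≡⟨ *-CS.xy∙z≈y∙xz (suc k) (suc n C suc k) (k C j) ⟩
    (suc n C suc k) * (suc k * (k C j))     ≡⟨ cong ((suc n C suc k) *_) ([1+k]*[1+n]C[1+k]≡[1+n]*nCk k j) ⟨
    (suc n C suc k) * (suc j * (suc k C suc j))
      ≡⟨ *-CS.x∙yz≈y∙xz (suc n C suc k) (suc j) (suc k C suc j) ⟩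
    suc j * ((suc n C suc k) * (suc k C suc j)) ∎)
    where
    n E : ℕ
    n = j + e
    E = shiftedC j e k

  trinomial-revision′ : ∀ {n j} k → j ≤ n → (n C j) * shiftedC j (n ∸ j) k ≡ (n C k) * (k C j)
  trinomial-revision′ {n} {j} k j≤n =
    subst (λ m → (m C j) * shiftedC j (n ∸ j) k ≡ (m C k) * (k C j)) (m+[n∸m]≡n j≤n)
          (trinomial-revision j (n ∸ j) k)

  -- Both divisions are exact: see [1+k]∣nCk*[n+k]Ck and n∣nC[1+j]*nCj.
  schröderCoeff : ℕ → ℕ → ℕ
  schröderCoeff n k = ((n C k) * ((n + k) C k)) / suc k

  narayana : (n : ℕ) .{{_ : NonZero n}} → ℕ → ℕ
  narayana n j = ((n C suc j) * (n C j)) / n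

  [1+k]*schröderCoeff≡nCk*[n+k]Ck : ∀ n k → suc k * schröderCoeff n k ≡ (n C k) * ((n + k) C k)
  [1+k]*schröderCoeff≡nCk*[n+k]Ck n k = m*[n/m]≡n ([1+k]∣nCk*[n+k]Ck n k)

  schröderCoeff-vanish : ∀ {n k} → n < k → schröderCoeff n k ≡ 0
  schröderCoeff-vanish {n} {k} n<k =
    trans (cong (λ c → (c * ((n + k) C k)) / suc k) (k>n⇒nCk≡0 n<k)) (0/n≡0 (suc k))

  nCk*[n+k]C[1+k]≡n*schröderCoeff : ∀ n k → (n C k) * ((n + k) C suc k) ≡ n * schröderCoeff n k
  nCk*[n+k]C[1+k]≡n*schröderCoeff n k = *-cancelˡ-≡ _ _ (suc k) (begin
    suc k * ((n C k) * ((n + k) C suc k))  ≡⟨ *-CS.x∙yz≈y∙xz (suc k) (n C k) ((n + k) C suc k) ⟩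
    (n C k) * (suc k * ((n + k) C suc k))  ≡⟨ cong ((n C k) *_) ([1+k]*[n+k]C[1+k]≡n*[n+k]Ck n k) ⟩
    (n C k) * (n * ((n + k) C k))          ≡⟨ *-CS.x∙yz≈y∙xz (n C k) n ((n + k) C k) ⟩
    n * ((n C k) * ((n + k) C k))          ≡⟨ cong (n *_) ([1+k]*schröderCoeff≡nCk*[n+k]Ck n k) ⟨
    n * (suc k * schröderCoeff n k)        ≡⟨ *-CS.x∙yz≈y∙xz n (suc k) (schröderCoeff n k) ⟩
    suc k * (n * schröderCoeff n k)        ∎)

  n*narayana*shiftedC≡nCk*nC[1+j]*kCj : ∀ n .{{_ : NonZero n}} {j} k → j ≤ n →
    n * (narayana n j * shiftedC j (n ∸ j) k) ≡ (n C k) * ((n C suc j) * (k C j))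
  n*narayana*shiftedC≡nCk*nC[1+j]*kCj n {j} k j≤n = begin
    n * (narayana n j * E)                  ≡⟨ *-assoc n (narayana n j) E ⟨
    (n * narayana n j) * E                  ≡⟨ cong (_* E) (m*[n/m]≡n (n∣nC[1+j]*nCj n j)) ⟩
    ((n C suc j) * (n C j)) * E             ≡⟨ *-assoc (n C suc j) (n C j) E ⟩
    (n C suc j) * ((n C j) * E)             ≡⟨ cong ((n C suc j) *_) (trinomial-revision′ k j≤n) ⟩
    (n C suc j) * ((n C k) * (k C j))       ≡⟨ *-CS.x∙yz≈y∙xz (n C suc j) (n C k) (k C j) ⟩
    (n C k) * ((n C suc j) * (k C j))       ∎
    where
    E : ℕ
    E = shiftedC j (n ∸ j) k

  [1+2n]Cn≡[1+2n]*schröderCoeff[n,n] : ∀ n → suc (n + n) C n ≡ suc (n + n) * schröderCoeff n n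
  [1+2n]Cn≡[1+2n]*schröderCoeff[n,n] n = *-cancelˡ-≡ _ _ (suc n) (begin
    suc n * (N C n)                     ≡⟨ cong (suc n *_) (nCk≡nC[n∸k] (m≤n+m n (suc n))) ⟩
    suc n * (N C (N ∸ n))               ≡⟨ cong (λ k → suc n * (N C k)) (m+n∸n≡m (suc n) n) ⟩
    suc n * (N C suc n)                 ≡⟨ [1+k]*[1+n]C[1+k]≡[1+n]*nCk (n + n) n ⟩
    N * ((n + n) C n)                   ≡⟨ cong (N *_) central ⟨
    N * (suc n * schröderCoeff n n)     ≡⟨ *-CS.x∙yz≈y∙xz N (suc n) (schröderCoeff n n) ⟩
    suc n * (N * schröderCoeff n n)     ∎)
    where
    N : ℕ
    N = suc (n + n)
    central : suc n * schröderCoeff n n ≡ (n + n) C n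
    central = trans ([1+k]*schröderCoeff≡nCk*[n+k]Ck n n)
                    (trans (cong (_* ((n + n) C n)) (nCn≡1 n)) (*-identityˡ _))

open import Defs
open import Level using (0ℓ)
open import Data.Nat as ℕ using (ℕ; zero; suc; _∸_; _<_; s≤s; NonZero)
import Data.Nat.Properties as ℕP
import Data.Nat.Divisibility as ℕ
open import Data.Nat.Primality
  using (Prime; euclidsLemma; prime⇒irreducible; prime⇒nonTrivial; irreducible[2])
open import Data.Nat.Combinatorics using (_C_; nCk+nC[k+1]≡[n+1]C[k+1]; nCn≡1; k>n⇒nCk≡0)
import Data.Nat.Tactic.RingSolver as ℕ-Solver
open import Data.Integer as ℤ using (ℤ; +_; -_; -[1+_]; _+_; _-_; _*_; _^_; ∣_∣)
open import Data.Integer.Properties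
open import Data.Integer.Divisibility using (_∣_)
import Data.Integer.Divisibility.Signed as Signed
open import Data.Integer.GCD using (gcd; gcd-greatest)
open import Data.Integer.Tactic.RingSolver using (solve-∀)
import Algebra.Properties.CommutativeSemigroup *-commutativeSemigroup as *-CS
import Algebra.Properties.CommutativeSemigroup +-commutativeSemigroup as +-CS
open import Data.Product using (∃-syntax; _×_; _,_)
open import Data.Sum using (_⊎_; inj₁; inj₂)
open import Relation.Nullary using (¬_; contradiction)
open import Relation.Binary using (IsEquivalence; Setoid)
import Relation.Binary.Reasoning.Setoid as SetoidReasoning
open import Relation.Binary.PropositionalEquality

open BinomialCoefficients

module FiniteSums where

  open ≡-Reasoning

  Σ<-cong : ∀ n {f g : ℕ → ℤ} → (∀ k → k < n → f k ≡ g k) → Σ< n f ≡ Σ< n g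
  Σ<-cong zero    f≡g = refl
  Σ<-cong (suc n) f≡g = cong₂ _+_ (Σ<-cong n (λ k k<n → f≡g k (ℕP.m<n⇒m<1+n k<n))) (f≡g n ℕP.≤-refl)

  Σ<-zero : ∀ n (f : ℕ → ℤ) → (∀ k → k < n → f k ≡ + 0) → Σ< n f ≡ + 0
  Σ<-zero zero    f f≡0 = refl
  Σ<-zero (suc n) f f≡0 = cong₂ _+_ (Σ<-zero n f (λ k k<n → f≡0 k (ℕP.m<n⇒m<1+n k<n))) (f≡0 n ℕP.≤-refl)

  Σ<-suc : ∀ n (f : ℕ → ℤ) → Σ< (suc n) f ≡ f 0 + Σ< n (λ k → f (suc k))
  Σ<-suc zero    f = +-comm (+ 0) (f 0)
  Σ<-suc (suc n) f = begin
    Σ< (suc n) f + f (suc n)                     ≡⟨ cong (_+ f (suc n)) (Σ<-suc n f) ⟩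
    f 0 + Σ< n (λ k → f (suc k)) + f (suc n)     ≡⟨ +-assoc (f 0) _ _ ⟩
    f 0 + (Σ< n (λ k → f (suc k)) + f (suc n))   ∎

  Σ<-distrib-+ : ∀ n (f g : ℕ → ℤ) → Σ< n (λ k → f k + g k) ≡ Σ< n f + Σ< n g
  Σ<-distrib-+ zero    f g = refl
  Σ<-distrib-+ (suc n) f g =
    trans (cong (_+ (f n + g n)) (Σ<-distrib-+ n f g)) (+-CS.interchange (Σ< n f) (Σ< n g) (f n) (g n))

  Σ<-distribˡ-* : ∀ n c (f : ℕ → ℤ) → c * Σ< n f ≡ Σ< n (λ k → c * f k)
  Σ<-distribˡ-* zero    c f = *-zeroʳ c
  Σ<-distribˡ-* (suc n) c f =
    trans (*-distribˡ-+ c (Σ< n f) (f n)) (cong (_+ c * f n) (Σ<-distribˡ-* n c f))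

  Σ<-distribʳ-* : ∀ n c (f : ℕ → ℤ) → Σ< n f * c ≡ Σ< n (λ k → f k * c)
  Σ<-distribʳ-* n c f =
    trans (*-comm (Σ< n f) c) (trans (Σ<-distribˡ-* n c f) (Σ<-cong n (λ k _ → *-comm c (f k))))

  Σ<-neg : ∀ n (f : ℕ → ℤ) → Σ< n (λ k → - f k) ≡ - Σ< n f
  Σ<-neg zero    f = refl
  Σ<-neg (suc n) f = trans (cong (_+ - f n) (Σ<-neg n f)) (sym (neg-distrib-+ (Σ< n f) (f n)))

  Σ<-pad : ∀ n d (f : ℕ → ℤ) → (∀ i → f (n ℕ.+ i) ≡ + 0) → Σ< (n ℕ.+ d) f ≡ Σ< n f
  Σ<-pad n zero    f tail≡0 = cong (λ t → Σ< t f) (ℕP.+-identityʳ n)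
  Σ<-pad n (suc d) f tail≡0 = begin
    Σ< (n ℕ.+ suc d) f            ≡⟨ cong (λ t → Σ< t f) (ℕP.+-suc n d) ⟩
    Σ< (n ℕ.+ d) f + f (n ℕ.+ d)  ≡⟨ cong₂ _+_ (Σ<-pad n d f tail≡0) (tail≡0 d) ⟩
    Σ< n f + + 0                  ≡⟨ +-identityʳ _ ⟩
    Σ< n f                        ∎

  Σ<-comm : ∀ a b (f : ℕ → ℕ → ℤ) → Σ< a (λ j → Σ< b (f j)) ≡ Σ< b (λ k → Σ< a (λ j → f j k))
  Σ<-comm zero    b f = sym (Σ<-zero b _ (λ _ _ → refl))
  Σ<-comm (suc a) b f = begin
    Σ< a (λ j → Σ< b (f j)) + Σ< b (f a)            ≡⟨ cong (_+ Σ< b (f a)) (Σ<-comm a b f) ⟩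
    Σ< b (λ k → Σ< a (λ j → f j k)) + Σ< b (f a)    ≡⟨ Σ<-distrib-+ b _ (f a) ⟨
    Σ< b (λ k → Σ< a (λ j → f j k) + f a k)         ∎

  Σ<-reverse : ∀ n (f : ℕ → ℤ) → Σ< n f ≡ Σ< n (λ k → f (n ∸ suc k))
  Σ<-reverse zero    f = refl
  Σ<-reverse (suc n) f = begin
    Σ< n f + f n                        ≡⟨ cong (_+ f n) (Σ<-reverse n f) ⟩
    Σ< n (λ k → f (n ∸ suc k)) + f n    ≡⟨ +-comm _ (f n) ⟩
    f n + Σ< n (λ k → f (n ∸ suc k))    ≡⟨ Σ<-suc n (λ k → f (suc n ∸ suc k)) ⟨
    Σ< (suc n) (λ k → f (suc n ∸ suc k)) ∎

open FiniteSums

module SchröderPolynomials where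

  open ≡-Reasoning

  pascalℤ : ∀ e k x → + (e C k) * x + + (e C suc k) * x ≡ + (suc e C suc k) * x
  pascalℤ e k x = begin
    + (e C k) * x + + (e C suc k) * x  ≡⟨ *-distribʳ-+ x (+ (e C k)) (+ (e C suc k)) ⟨
    (+ (e C k) + + (e C suc k)) * x    ≡⟨ cong (_* x) (pos-+ (e C k) (e C suc k)) ⟨
    + (e C k ℕ.+ e C suc k) * x        ≡⟨ cong (λ t → + t * x) (nCk+nC[k+1]≡[n+1]C[k+1] e k) ⟩
    + (suc e C suc k) * x              ∎

  binomial : ∀ z e → (z + + 1) ^ e ≡ Σ< (suc e) (λ k → + (e C k) * z ^ k)
  binomial z zero    = refl
  binomial z (suc e) = begin
    (z + + 1) * (z + + 1) ^ e   ≡⟨ cong ((z + + 1) *_) (binomial z e) ⟩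
    (z + + 1) * S               ≡⟨ *-distribʳ-+ S z (+ 1) ⟩
    z * S + + 1 * S             ≡⟨ cong₂ _+_ zS≡U (trans (*-identityˡ S) S≡1+W) ⟩
    U + (+ 1 + W)               ≡⟨ +-CS.x∙yz≈y∙xz U (+ 1) W ⟩
    + 1 + (U + W)               ≡⟨ cong (_+_ (+ 1)) (Σ<-distrib-+ (suc e) _ _) ⟨
    + 1 + Σ< (suc e) (λ k → + (e C k) * z ^ suc k + + (e C suc k) * z ^ suc k)
        ≡⟨ cong (_+_ (+ 1)) (Σ<-cong (suc e) (λ k _ → pascalℤ e k (z ^ suc k))) ⟩
    + 1 + Σ< (suc e) (λ k → + (suc e C suc k) * z ^ suc k)
        ≡⟨ Σ<-suc (suc e) (λ k → + (suc e C k) * z ^ k) ⟨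
    Σ< (suc (suc e)) (λ k → + (suc e C k) * z ^ k) ∎
    where
    S = Σ< (suc e) (λ k → + (e C k) * z ^ k)
    U = Σ< (suc e) (λ k → + (e C k) * z ^ suc k)
    W = Σ< (suc e) (λ k → + (e C suc k) * z ^ suc k)
    zS≡U : z * S ≡ U
    zS≡U = trans (Σ<-distribˡ-* (suc e) z _)
                 (Σ<-cong (suc e) (λ k _ → *-CS.x∙yz≈y∙xz z (+ (e C k)) (z ^ k)))
    S≡1+W : S ≡ + 1 + W
    S≡1+W = trans (Σ<-suc e _) (cong (_+_ (+ 1)) (sym W≡))
      where
      W≡ : W ≡ Σ< e (λ k → + (e C suc k) * z ^ suc k)
      W≡ = trans (cong (λ t → Σ< e (λ k → + (e C suc k) * z ^ suc k) + + t * z ^ suc e)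
                       (k>n⇒nCk≡0 (ℕP.n<1+n e)))
                 (+-identityʳ _)

  shifted-binomial : ∀ z j e → z ^ j * (z + + 1) ^ e ≡ Σ< (suc (j ℕ.+ e)) (λ k → + shiftedC j e k * z ^ k)
  shifted-binomial z zero    e = trans (*-identityˡ _) (binomial z e)
  shifted-binomial z (suc j) e = begin
    z * z ^ j * (z + + 1) ^ e                            ≡⟨ *-assoc z (z ^ j) _ ⟩
    z * (z ^ j * (z + + 1) ^ e)                          ≡⟨ cong (z *_) (shifted-binomial z j e) ⟩
    z * Σ< (suc (j ℕ.+ e)) (λ k → + shiftedC j e k * z ^ k)
      ≡⟨ Σ<-distribˡ-* (suc (j ℕ.+ e)) z _ ⟩
    Σ< (suc (j ℕ.+ e)) (λ k → z * (+ shiftedC j e k * z ^ k))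
      ≡⟨ Σ<-cong (suc (j ℕ.+ e)) (λ k _ → *-CS.x∙yz≈y∙xz z (+ shiftedC j e k) (z ^ k)) ⟩
    Σ< (suc (j ℕ.+ e)) (λ k → + shiftedC j e k * z ^ suc k)
      ≡⟨ +-identityˡ _ ⟨
    + 0 + Σ< (suc (j ℕ.+ e)) (λ k → + shiftedC j e k * z ^ suc k)
      ≡⟨ Σ<-suc (suc (j ℕ.+ e)) (λ k → + shiftedC (suc j) e k * z ^ k) ⟨
    Σ< (suc (suc j ℕ.+ e)) (λ k → + shiftedC (suc j) e k * z ^ k) ∎

  vandermonde : ∀ n k t → Σ< (suc k) (λ j → + ((n C (t ℕ.+ j)) ℕ.* (k C j))) ≡ + ((n ℕ.+ k) C (t ℕ.+ k))
  vandermonde n zero    t =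
    cong +_ (trans (ℕP.*-identityʳ _) (cong (_C (t ℕ.+ 0)) (sym (ℕP.+-identityʳ n))))
  vandermonde n (suc k) t = begin
    Σ< (suc (suc k)) (λ j → + ((n C (t ℕ.+ j)) ℕ.* (suc k C j)))
      ≡⟨ Σ<-suc (suc k) _ ⟩
    H + Σ< (suc k) (λ j → + ((n C (t ℕ.+ suc j)) ℕ.* (suc k C suc j)))
      ≡⟨ cong (_+_ H) (Σ<-cong (suc k) (λ j _ → pascal-split j)) ⟩
    H + Σ< (suc k) (λ j → + ((n C (t ℕ.+ suc j)) ℕ.* (k C j))
                        + + ((n C (t ℕ.+ suc j)) ℕ.* (k C suc j)))
      ≡⟨ cong (_+_ H) (Σ<-distrib-+ (suc k) _ _) ⟩
    H + (U + W)                                          ≡⟨ +-CS.x∙yz≈xz∙y H U W ⟩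
    (H + W) + U                                          ≡⟨ cong₂ _+_ H+W≡ U≡ ⟩
    + ((n ℕ.+ k) C (t ℕ.+ k)) + + ((n ℕ.+ k) C suc (t ℕ.+ k))
      ≡⟨ pos-+ ((n ℕ.+ k) C (t ℕ.+ k)) ((n ℕ.+ k) C suc (t ℕ.+ k)) ⟨
    + ((n ℕ.+ k) C (t ℕ.+ k) ℕ.+ (n ℕ.+ k) C suc (t ℕ.+ k))
      ≡⟨ cong +_ (nCk+nC[k+1]≡[n+1]C[k+1] (n ℕ.+ k) (t ℕ.+ k)) ⟩
    + (suc (n ℕ.+ k) C suc (t ℕ.+ k))
      ≡⟨ cong₂ (λ a b → + (a C b)) (ℕP.+-suc n k) (ℕP.+-suc t k) ⟨
    + ((n ℕ.+ suc k) C (t ℕ.+ suc k)) ∎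
    where
    H U W : ℤ
    H = + ((n C (t ℕ.+ 0)) ℕ.* 1)
    U = Σ< (suc k) (λ j → + ((n C (t ℕ.+ suc j)) ℕ.* (k C j)))
    W = Σ< (suc k) (λ j → + ((n C (t ℕ.+ suc j)) ℕ.* (k C suc j)))
    pascal-split : ∀ j → + ((n C (t ℕ.+ suc j)) ℕ.* (suc k C suc j))
                       ≡ + ((n C (t ℕ.+ suc j)) ℕ.* (k C j)) + + ((n C (t ℕ.+ suc j)) ℕ.* (k C suc j))
    pascal-split j =
      trans (cong +_ (trans (cong (a ℕ.*_) (pascal k j)) (ℕP.*-distribˡ-+ a (k C j) (k C suc j))))
            (pos-+ (a ℕ.* (k C j)) (a ℕ.* (k C suc j)))
      where
      a : ℕ
      a = n C (t ℕ.+ suc j)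
    V : ℕ → ℤ
    V j = + ((n C (t ℕ.+ j)) ℕ.* (k C j))
    V-top≡0 : V (suc k) ≡ + 0
    V-top≡0 = cong +_ (trans (cong ((n C (t ℕ.+ suc k)) ℕ.*_) (k>n⇒nCk≡0 (ℕP.n<1+n k)))
                             (ℕP.*-zeroʳ (n C (t ℕ.+ suc k))))
    H+W≡ : H + W ≡ + ((n ℕ.+ k) C (t ℕ.+ k))
    H+W≡ = begin
      H + W                        ≡⟨ Σ<-suc (suc k) V ⟨
      Σ< (suc k) V + V (suc k)     ≡⟨ cong (_+_ (Σ< (suc k) V)) V-top≡0 ⟩
      Σ< (suc k) V + + 0           ≡⟨ +-identityʳ _ ⟩
      Σ< (suc k) V                 ≡⟨ vandermonde n k t ⟩
      + ((n ℕ.+ k) C (t ℕ.+ k))    ∎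
    U≡ : U ≡ + ((n ℕ.+ k) C suc (t ℕ.+ k))
    U≡ = trans (Σ<-cong (suc k) (λ j _ → cong (λ i → + ((n C i) ℕ.* (k C j))) (ℕP.+-suc t j)))
               (vandermonde n k (suc t))

  vandermonde′ : ∀ n k → Σ< n (λ j → + ((n C suc j) ℕ.* (k C j))) ≡ + ((n ℕ.+ k) C suc k)
  vandermonde′ n k = begin
    Σ< n f               ≡⟨ Σ<-pad n (suc k) f (λ i → cong (λ c → + (c ℕ.* (k C (n ℕ.+ i))))
                                                          (k>n⇒nCk≡0 (s≤s (ℕP.m≤m+n n i)))) ⟨
    Σ< (n ℕ.+ suc k) f   ≡⟨ cong (λ m → Σ< m f) (ℕP.+-comm n (suc k)) ⟩
    Σ< (suc k ℕ.+ n) f   ≡⟨ Σ<-pad (suc k) n f (λ i → cong +_ (trans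
                               (cong ((n C suc (suc k ℕ.+ i)) ℕ.*_) (k>n⇒nCk≡0 (s≤s (ℕP.m≤m+n k i))))
                               (ℕP.*-zeroʳ (n C suc (suc k ℕ.+ i))))) ⟩
    Σ< (suc k) f         ≡⟨ vandermonde n k 1 ⟩
    + ((n ℕ.+ k) C suc k) ∎
    where
    f : ℕ → ℤ
    f j = + ((n C suc j) ℕ.* (k C j))

  Σ<-narayana*shiftedC≡schröderCoeff : ∀ n .{{_ : NonZero n}} k →
    Σ< n (λ j → + (narayana n j ℕ.* shiftedC j (n ∸ j) k)) ≡ + schröderCoeff n k
  Σ<-narayana*shiftedC≡schröderCoeff n k = *-cancelˡ-≡ (+ n) _ _ (begin
    + n * Σ< n (λ j → + T j)                                  ≡⟨ Σ<-distribˡ-* n (+ n) _ ⟩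
    Σ< n (λ j → + n * + T j)                                  ≡⟨ Σ<-cong n termwise ⟩
    Σ< n (λ j → + (n C k) * + ((n C suc j) ℕ.* (k C j)))      ≡⟨ Σ<-distribˡ-* n (+ (n C k)) _ ⟨
    + (n C k) * Σ< n (λ j → + ((n C suc j) ℕ.* (k C j)))      ≡⟨ cong (_*_ (+ (n C k))) (vandermonde′ n k) ⟩
    + (n C k) * + ((n ℕ.+ k) C suc k)                         ≡⟨ pos-* (n C k) ((n ℕ.+ k) C suc k) ⟨
    + ((n C k) ℕ.* ((n ℕ.+ k) C suc k))                       ≡⟨ cong +_ (nCk*[n+k]C[1+k]≡n*schröderCoeff n k) ⟩
    + (n ℕ.* schröderCoeff n k)                               ≡⟨ pos-* n (schröderCoeff n k) ⟩
    + n * + schröderCoeff n k                                 ∎)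
    where
    T : ℕ → ℕ
    T j = narayana n j ℕ.* shiftedC j (n ∸ j) k
    termwise : ∀ j → j < n → + n * + T j ≡ + (n C k) * + ((n C suc j) ℕ.* (k C j))
    termwise j j<n = begin
      + n * + T j                                     ≡⟨ pos-* n (T j) ⟨
      + (n ℕ.* T j)
        ≡⟨ cong +_ (n*narayana*shiftedC≡nCk*nC[1+j]*kCj n k (ℕP.<⇒≤ j<n)) ⟩
      + ((n C k) ℕ.* ((n C suc j) ℕ.* (k C j)))       ≡⟨ pos-* (n C k) _ ⟩
      + (n C k) * + ((n C suc j) ℕ.* (k C j))         ∎

  largeS≡[z+1]*littleS : ∀ m z → largeS (suc m) z ≡ (z + + 1) * littleS (suc m) z
  largeS≡[z+1]*littleS m z = sym (begin
    (z + + 1) * littleS n z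
      ≡⟨ Σ<-distribˡ-* n (z + + 1) _ ⟩
    Σ< n (λ j → (z + + 1) * (+ narayana n j * (z ^ j * (z + + 1) ^ (m ∸ j))))
      ≡⟨ Σ<-cong n expand ⟩
    Σ< n (λ j → + narayana n j * Σ< (suc n) (λ k → + shiftedC j (n ∸ j) k * z ^ k))
      ≡⟨ Σ<-cong n (λ j _ → Σ<-distribˡ-* (suc n) (+ narayana n j) _) ⟩
    Σ< n (λ j → Σ< (suc n) (λ k → + narayana n j * (+ shiftedC j (n ∸ j) k * z ^ k)))
      ≡⟨ Σ<-comm n (suc n) _ ⟩
    Σ< (suc n) (λ k → Σ< n (λ j → + narayana n j * (+ shiftedC j (n ∸ j) k * z ^ k)))
      ≡⟨ Σ<-cong (suc n) (λ k _ → collect k) ⟩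
    largeS n z ∎)
    where
    n : ℕ
    n = suc m
    expand : ∀ j → j < n → (z + + 1) * (+ narayana n j * (z ^ j * (z + + 1) ^ (m ∸ j)))
                         ≡ + narayana n j * Σ< (suc n) (λ k → + shiftedC j (n ∸ j) k * z ^ k)
    expand j (s≤s j≤m) = begin
      (z + + 1) * (+ narayana n j * (z ^ j * (z + + 1) ^ (m ∸ j)))
        ≡⟨ *-CS.x∙yz≈y∙xz (z + + 1) (+ narayana n j) _ ⟩
      + narayana n j * ((z + + 1) * (z ^ j * (z + + 1) ^ (m ∸ j)))
        ≡⟨ cong (_*_ (+ narayana n j)) (*-CS.x∙yz≈y∙xz (z + + 1) (z ^ j) _) ⟩
      + narayana n j * (z ^ j * (z + + 1) ^ suc (m ∸ j))
        ≡⟨ cong (λ e → + narayana n j * (z ^ j * (z + + 1) ^ e)) (ℕP.+-∸-assoc 1 j≤m) ⟨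
      + narayana n j * (z ^ j * (z + + 1) ^ (n ∸ j))
        ≡⟨ cong (_*_ (+ narayana n j)) (shifted-binomial z j (n ∸ j)) ⟩
      + narayana n j * Σ< (suc (j ℕ.+ (n ∸ j))) (λ k → + shiftedC j (n ∸ j) k * z ^ k)
        ≡⟨ cong (λ i → + narayana n j * Σ< (suc i) (λ k → + shiftedC j (n ∸ j) k * z ^ k))
                (ℕP.m+[n∸m]≡n (ℕP.m≤n⇒m≤1+n j≤m)) ⟩
      + narayana n j * Σ< (suc n) (λ k → + shiftedC j (n ∸ j) k * z ^ k) ∎
    collect : ∀ k → Σ< n (λ j → + narayana n j * (+ shiftedC j (n ∸ j) k * z ^ k))
                  ≡ + schröderCoeff n k * z ^ k
    collect k = begin
      Σ< n (λ j → + narayana n j * (+ shiftedC j (n ∸ j) k * z ^ k))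
        ≡⟨ Σ<-cong n (λ j _ → trans (sym (*-assoc (+ narayana n j) _ (z ^ k)))
                                    (cong (_* z ^ k) (sym (pos-* (narayana n j) _)))) ⟩
      Σ< n (λ j → + (narayana n j ℕ.* shiftedC j (n ∸ j) k) * z ^ k)
        ≡⟨ Σ<-distribʳ-* n (z ^ k) _ ⟨
      Σ< n (λ j → + (narayana n j ℕ.* shiftedC j (n ∸ j) k)) * z ^ k
        ≡⟨ cong (_* z ^ k) (Σ<-narayana*shiftedC≡schröderCoeff n k) ⟩
      + schröderCoeff n k * z ^ k ∎

  [1+j]*[b+1+j]C[1+j]≡[1+b+j]*[b+j]Cj : ∀ b j →
    + suc j * + ((b ℕ.+ suc j) C suc j) ≡ + suc (b ℕ.+ j) * + ((b ℕ.+ j) C j)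
  [1+j]*[b+1+j]C[1+j]≡[1+b+j]*[b+j]Cj b j = begin
    + suc j * + ((b ℕ.+ suc j) C suc j)        ≡⟨ pos-* (suc j) _ ⟨
    + (suc j ℕ.* ((b ℕ.+ suc j) C suc j))      ≡⟨ cong (λ n → + (suc j ℕ.* (n C suc j))) (ℕP.+-suc b j) ⟩
    + (suc j ℕ.* (suc (b ℕ.+ j) C suc j))      ≡⟨ cong +_ ([1+k]*[1+n]C[1+k]≡[1+n]*nCk (b ℕ.+ j) j) ⟩
    + (suc (b ℕ.+ j) ℕ.* ((b ℕ.+ j) C j))      ≡⟨ pos-* (suc (b ℕ.+ j)) _ ⟩
    + suc (b ℕ.+ j) * + ((b ℕ.+ j) C j)        ∎

  [1+j]*aC[1+j]≡[a-j]*aCj : ∀ a j → + suc j * + (a C suc j) ≡ (+ a - + j) * + (a C j)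
  [1+j]*aC[1+j]≡[a-j]*aCj a j = begin
    + suc j * + (a C suc j)
      ≡⟨ isolate (+ suc j * + (a C suc j)) (+ suc j * + (a C j)) ⟩
    (+ suc j * + (a C suc j) + + suc j * + (a C j)) - + suc j * + (a C j)
      ≡⟨ cong (_- + suc j * + (a C j)) absorb ⟩
    + suc a * + (a C j) - + suc j * + (a C j)                 ≡⟨ factor (+ a) (+ j) (+ (a C j)) ⟩
    (+ a - + j) * + (a C j)                                   ∎
    where
    isolate : ∀ x y → x ≡ (x + y) - y
    isolate = solve-∀
    factor : ∀ a j y → (+ 1 + a) * y - (+ 1 + j) * y ≡ (a - j) * y
    factor = solve-∀
    absorb : + suc j * + (a C suc j) + + suc j * + (a C j) ≡ + suc a * + (a C j)
    absorb = begin
      + suc j * + (a C suc j) + + suc j * + (a C j)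
        ≡⟨ cong₂ _+_ (pos-* (suc j) (a C suc j)) (pos-* (suc j) (a C j)) ⟨
      + (suc j ℕ.* (a C suc j)) + + (suc j ℕ.* (a C j))
        ≡⟨ pos-+ (suc j ℕ.* (a C suc j)) (suc j ℕ.* (a C j)) ⟨
      + (suc j ℕ.* (a C suc j) ℕ.+ suc j ℕ.* (a C j))      ≡⟨ cong +_ ([1+k]*nC[1+k]+[1+k]*nCk≡[1+n]*nCk a j) ⟩
      + (suc a ℕ.* (a C j))                                ≡⟨ pos-* (suc a) (a C j) ⟩
      + suc a * + (a C j)                                  ∎

open SchröderPolynomials

module Congruence (p : ℕ) where

  -- A record rather than a synonym for the divisibility, so that x and y stay inferable.
  infix 4 _≈_
  record _≈_ (x y : ℤ) : Set where
    constructor divides-difference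
    field divisible : + p Signed.∣ x - y
  open _≈_ public

  private
    transport : ∀ {x y u} → u ≡ x - y → + p Signed.∣ u → x ≈ y
    transport eq p∣u = divides-difference (subst (+ p Signed.∣_) eq p∣u)

  ∣⇒≈0 : ∀ {x} → + p ∣ x → x ≈ + 0
  ∣⇒≈0 {x} p∣x = transport (sym (+-identityʳ x)) (Signed.∣ᵤ⇒∣ p∣x)

  ≈⇒∣ : ∀ {x y} → x ≈ y → + p ∣ x - y
  ≈⇒∣ x≈y = Signed.∣⇒∣ᵤ (divisible x≈y)

  ≡⇒≈ : ∀ {x y} → x ≡ y → x ≈ y
  ≡⇒≈ {x} refl = transport (x-x≡0 x) (Signed.divides (+ 0) refl)
    where
    x-x≡0 : ∀ x → + 0 ≡ x - x
    x-x≡0 = solve-∀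

  ≈-refl : ∀ {x} → x ≈ x
  ≈-refl = ≡⇒≈ refl

  ≈-sym : ∀ {x y} → x ≈ y → y ≈ x
  ≈-sym {x} {y} x≈y = transport (swap x y) (Signed.∣m⇒∣-m (divisible x≈y))
    where
    swap : ∀ x y → - (x - y) ≡ y - x
    swap = solve-∀

  ≈-trans : ∀ {x y z} → x ≈ y → y ≈ z → x ≈ z
  ≈-trans {x} {y} {z} x≈y y≈z =
    transport (telescope x y z) (Signed.∣m∣n⇒∣m+n (divisible x≈y) (divisible y≈z))
    where
    telescope : ∀ x y z → (x - y) + (y - z) ≡ x - z
    telescope = solve-∀

  ≈-isEquivalence : IsEquivalence _≈_
  ≈-isEquivalence = record { refl = ≈-refl ; sym = ≈-sym ; trans = ≈-trans }

  ≈-setoid : Setoid 0ℓ 0ℓ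
  ≈-setoid = record { isEquivalence = ≈-isEquivalence }

  module ≈-Reasoning = SetoidReasoning ≈-setoid

  ≈-+ : ∀ {x x′ y y′} → x ≈ x′ → y ≈ y′ → x + y ≈ x′ + y′
  ≈-+ {x} {x′} {y} {y′} x≈x′ y≈y′ =
    transport (split x x′ y y′) (Signed.∣m∣n⇒∣m+n (divisible x≈x′) (divisible y≈y′))
    where
    split : ∀ x x′ y y′ → (x - x′) + (y - y′) ≡ (x + y) - (x′ + y′)
    split = solve-∀

  ≈-* : ∀ {x x′ y y′} → x ≈ x′ → y ≈ y′ → x * y ≈ x′ * y′
  ≈-* {x} {x′} {y} {y′} x≈x′ y≈y′ =
    transport (split x x′ y y′)
              (Signed.∣m∣n⇒∣m+n (Signed.∣n⇒∣m*n x (divisible y≈y′)) (Signed.∣m⇒∣m*n y′ (divisible x≈x′)))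
    where
    split : ∀ x x′ y y′ → x * (y - y′) + (x - x′) * y′ ≡ x * y - x′ * y′
    split = solve-∀

  ≈-neg : ∀ {x y} → x ≈ y → - x ≈ - y
  ≈-neg {x} {y} x≈y = transport (split x y) (Signed.∣m⇒∣-m (divisible x≈y))
    where
    split : ∀ x y → - (x - y) ≡ - x - - y
    split = solve-∀

  ≈-^ : ∀ {x y} n → x ≈ y → x ^ n ≈ y ^ n
  ≈-^ zero    x≈y = ≈-refl
  ≈-^ (suc n) x≈y = ≈-* x≈y (≈-^ n x≈y)

  Σ<-cong-≈ : ∀ n {f g : ℕ → ℤ} → (∀ k → k < n → f k ≈ g k) → Σ< n f ≈ Σ< n g
  Σ<-cong-≈ zero    f≈g = ≈-refl
  Σ<-cong-≈ (suc n) f≈g = ≈-+ (Σ<-cong-≈ n (λ k k<n → f≈g k (ℕP.m<n⇒m<1+n k<n))) (f≈g n ℕP.≤-refl)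

  Σ<-reflect-antisymmetric : ∀ n (f : ℕ → ℤ) → (∀ k → k < n → f (n ∸ suc k) ≈ - f k) →
                             + 2 * Σ< n f ≈ + 0
  Σ<-reflect-antisymmetric n f anti = begin
    + 2 * Σ< n f                          ≡⟨ double (Σ< n f) ⟩
    Σ< n f + Σ< n f                       ≡⟨ cong (_+ Σ< n f) (Σ<-reverse n f) ⟩
    Σ< n (λ k → f (n ∸ suc k)) + Σ< n f   ≈⟨ ≈-+ (Σ<-cong-≈ n anti) ≈-refl ⟩
    Σ< n (λ k → - f k) + Σ< n f           ≡⟨ cong (_+ Σ< n f) (Σ<-neg n f) ⟩
    - Σ< n f + Σ< n f                     ≡⟨ cancel (Σ< n f) ⟩
    + 0                                   ∎
    where
    open ≈-Reasoning
    double : ∀ s → + 2 * s ≡ s + s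
    double = solve-∀
    cancel : ∀ s → - s + s ≡ + 0
    cancel = solve-∀

module PrimeModulus {q : ℕ} (p-prime : Prime (suc q)) where

  p : ℕ
  p = suc q

  open Congruence p

  p∤[1+j] : ∀ {j} → suc j < p → ¬ (+ p ∣ + suc j)
  p∤[1+j] 1+j<p p∣1+j = ℕP.<⇒≱ 1+j<p (ℕ.∣⇒≤ p∣1+j)

  ≈-cancelˡ : ∀ c {x y} → ¬ (+ p ∣ c) → c * x ≈ c * y → x ≈ y
  ≈-cancelˡ c {x} {y} p∤c cx≈cy with euclidsLemma ∣ c ∣ ∣ x - y ∣ p-prime p∣∣c∣*∣x-y∣
    where
    factor : ∀ c x y → c * x - c * y ≡ c * (x - y)
    factor = solve-∀
    p∣∣c∣*∣x-y∣ : p ℕ.∣ ∣ c ∣ ℕ.* ∣ x - y ∣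
    p∣∣c∣*∣x-y∣ = subst (p ℕ.∣_) (abs-* c (x - y)) (subst (+ p ∣_) (factor c x y) (≈⇒∣ cx≈cy))
  ... | inj₁ p∣c   = contradiction p∣c p∤c
  ... | inj₂ p∣x-y = divides-difference (Signed.∣ᵤ⇒∣ p∣x-y)

  p∣pC[1+k] : ∀ {k} → k < q → p ℕ.∣ p C suc k
  p∣pC[1+k] {k} k<q with euclidsLemma (suc k) (p C suc k) p-prime
                           (ℕ.divides (q C k) (trans ([1+k]*[1+n]C[1+k]≡[1+n]*nCk q k) (ℕP.*-comm p (q C k))))
  ... | inj₁ p∣1+k = contradiction p∣1+k (p∤[1+j] (s≤s k<q))
  ... | inj₂ p∣pC[1+k] = p∣pC[1+k]

  fermat-ℕ : ∀ a → (+ a) ^ p ≈ + a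
  fermat-ℕ zero    = ≈-refl
  fermat-ℕ (suc a) = begin
    (+ suc a) ^ p                                            ≡⟨ cong (λ n → (+ n) ^ p) (ℕP.+-comm 1 a) ⟩
    (+ (a ℕ.+ 1)) ^ p                                        ≡⟨ cong (_^ p) (pos-+ a 1) ⟩
    (+ a + + 1) ^ p                                          ≡⟨ binomial (+ a) p ⟩
    Σ< (suc p) (λ k → + (p C k) * (+ a) ^ k)                 ≡⟨ Σ<-suc p _ ⟩
    + 1 + (Σ< q middle + + (p C p) * (+ a) ^ p)
      ≈⟨ ≈-+ (≈-refl {+ 1}) (≈-+ middle≈0 (≈-* (≡⇒≈ (cong +_ (nCn≡1 p))) (fermat-ℕ a))) ⟩
    + 1 + (+ 0 + + 1 * + a)                                  ≡⟨ tidy (+ a) ⟩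
    + suc a                                                  ∎
    where
    open ≈-Reasoning
    middle : ℕ → ℤ
    middle k = + (p C suc k) * (+ a) ^ suc k
    middle≈0 : Σ< q middle ≈ + 0
    middle≈0 = ≈-trans (Σ<-cong-≈ q (λ k k<q → ≈-* (∣⇒≈0 {+ (p C suc k)} (p∣pC[1+k] k<q))
                                                  (≈-refl {(+ a) ^ suc k})))
                       (≡⇒≈ (Σ<-zero q _ (λ _ _ → refl)))
    tidy : ∀ x → + 1 + (+ 0 + + 1 * x) ≡ + 1 + x
    tidy = solve-∀

  complement≈ : ∀ {a b} t → a ℕ.+ suc b ≡ t ℕ.* p → + a ≈ - + suc b
  complement≈ {a} {b} t a+1+b≡tp = divides-difference (Signed.divides (+ t) (begin
    + a - - + suc b       ≡⟨ minus-neg (+ a) (+ suc b) ⟩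
    + a + + suc b         ≡⟨ pos-+ a (suc b) ⟨
    + (a ℕ.+ suc b)       ≡⟨ cong +_ a+1+b≡tp ⟩
    + (t ℕ.* p)           ≡⟨ pos-* t p ⟩
    + t * + p             ∎))
    where
    open ≡-Reasoning
    minus-neg : ∀ x y → x - - y ≡ x + y
    minus-neg = solve-∀

  -- The binomial coefficient C(-1-b, j) = (-1)ʲ C(b+j, j), read modulo p.
  aCj≈[-1]ʲ*[b+j]Cj : ∀ {a b} → + a ≈ - + suc b → ∀ j → j < p →
                      + (a C j) ≈ (- + 1) ^ j * + ((b ℕ.+ j) C j)
  aCj≈[-1]ʲ*[b+j]Cj a≈-1-b zero    _     = ≈-refl
  aCj≈[-1]ʲ*[b+j]Cj {a} {b} a≈-1-b (suc j) 1+j<p = ≈-cancelˡ (+ suc j) (p∤[1+j] 1+j<p) (begin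
    + suc j * + (a C suc j)                                  ≡⟨ [1+j]*aC[1+j]≡[a-j]*aCj a j ⟩
    (+ a - + j) * + (a C j)
      ≈⟨ ≈-* (≈-+ a≈-1-b (≈-refl { - + j})) (aCj≈[-1]ʲ*[b+j]Cj a≈-1-b j (ℕP.<⇒≤ 1+j<p)) ⟩
    (- + suc b - + j) * ((- + 1) ^ j * + ((b ℕ.+ j) C j))     ≡⟨ regroup (+ b) (+ j) ((- + 1) ^ j) _ ⟩
    (- + 1) ^ suc j * (+ suc (b ℕ.+ j) * + ((b ℕ.+ j) C j))
      ≡⟨ cong (_*_ ((- + 1) ^ suc j)) ([1+j]*[b+1+j]C[1+j]≡[1+b+j]*[b+j]Cj b j) ⟨
    (- + 1) ^ suc j * (+ suc j * + ((b ℕ.+ suc j) C suc j))   ≡⟨ *-CS.x∙yz≈y∙xz ((- + 1) ^ suc j) (+ suc j) _ ⟩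
    + suc j * ((- + 1) ^ suc j * + ((b ℕ.+ suc j) C suc j))   ∎)
    where
    open ≈-Reasoning
    regroup : ∀ b j s y → (- (+ 1 + b) - j) * (s * y) ≡ ((- + 1) * s) * ((+ 1 + (b + j)) * y)
    regroup = solve-∀

  schröderCoeff-reflect : ∀ {k k′} → suc (k ℕ.+ k′) ≡ p → ∀ j → suc j < p →
                          + schröderCoeff k j ≈ + schröderCoeff k′ j
  schröderCoeff-reflect {k} {k′} 1+k+k′≡p j 1+j<p = ≈-cancelˡ (+ suc j) (p∤[1+j] 1+j<p) (begin
    + suc j * + schröderCoeff k j                          ≡⟨ clear-denominator k ⟩
    + (k C j) * + ((k ℕ.+ j) C j)                          ≈⟨ ≈-* (negate 1+k+k′≡p) ≈-refl ⟩
    ((- + 1) ^ j * + ((k′ ℕ.+ j) C j)) * + ((k ℕ.+ j) C j)  ≡⟨ *-CS.xy∙z≈xz∙y ((- + 1) ^ j) _ _ ⟩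
    ((- + 1) ^ j * + ((k ℕ.+ j) C j)) * + ((k′ ℕ.+ j) C j)  ≈⟨ ≈-* (≈-sym (negate 1+k′+k≡p)) ≈-refl ⟩
    + (k′ C j) * + ((k′ ℕ.+ j) C j)                        ≡⟨ clear-denominator k′ ⟨
    + suc j * + schröderCoeff k′ j                         ∎)
    where
    open ≈-Reasoning
    1+k′+k≡p : suc (k′ ℕ.+ k) ≡ p
    1+k′+k≡p = trans (cong suc (ℕP.+-comm k′ k)) 1+k+k′≡p
    negate : ∀ {a b} → suc (a ℕ.+ b) ≡ p → + (a C j) ≈ (- + 1) ^ j * + ((b ℕ.+ j) C j)
    negate {a} {b} 1+a+b≡p = aCj≈[-1]ʲ*[b+j]Cj (complement≈ 1 a+1+b≡1*p) j (ℕP.<⇒≤ 1+j<p)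
      where
      a+1+b≡1*p : a ℕ.+ suc b ≡ 1 ℕ.* p
      a+1+b≡1*p = trans (ℕP.+-suc a b) (trans 1+a+b≡p (sym (ℕP.*-identityˡ p)))
    clear-denominator : ∀ n → + suc j * + schröderCoeff n j ≡ + (n C j) * + ((n ℕ.+ j) C j)
    clear-denominator n = trans (sym (pos-* (suc j) _))
      (trans (cong +_ ([1+k]*schröderCoeff≡nCk*[n+k]Ck n j)) (pos-* (n C j) _))

[-x]^[2k]≡x^[2k] : ∀ x k → (- x) ^ (2 ℕ.* k) ≡ x ^ (2 ℕ.* k)
[-x]^[2k]≡x^[2k] x k = begin
  (- x) ^ (2 ℕ.* k)    ≡⟨ ^-*-assoc (- x) 2 k ⟨
  ((- x) ^ 2) ^ k      ≡⟨ cong (_^ k) (square-neg x) ⟩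
  (x ^ 2) ^ k          ≡⟨ ^-*-assoc x 2 k ⟩
  x ^ (2 ℕ.* k)        ∎
  where
  open ≡-Reasoning
  square-neg : ∀ x → (- x) * ((- x) * + 1) ≡ x * (x * + 1)
  square-neg = solve-∀

[-x]^[1+2k]≡-x^[1+2k] : ∀ x k → (- x) ^ suc (2 ℕ.* k) ≡ - x ^ suc (2 ℕ.* k)
[-x]^[1+2k]≡-x^[1+2k] x k = trans (cong (_*_ (- x)) ([-x]^[2k]≡x^[2k] x k)) (sym (neg-distribˡ-* x _))

±1^[2k]≡1 : ∀ {ε} → ε ≡ + 1 ⊎ ε ≡ - + 1 → ∀ k → ε ^ (2 ℕ.* k) ≡ + 1
±1^[2k]≡1 (inj₁ refl) k = ^-zeroˡ (2 ℕ.* k)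
±1^[2k]≡1 (inj₂ refl) k = trans ([-x]^[2k]≡x^[2k] (+ 1) k) (^-zeroˡ (2 ℕ.* k))

±1^-reflect : ∀ {ε} → ε ≡ + 1 ⊎ ε ≡ - + 1 → ∀ {h k k′} → k ℕ.+ k′ ≡ 2 ℕ.* h → ε ^ k′ ≡ ε ^ k
±1^-reflect {ε} ε≡±1 {h} {k} {k′} k+k′≡2h = begin
  ε ^ k′                        ≡⟨ *-identityʳ (ε ^ k′) ⟨
  ε ^ k′ * + 1                  ≡⟨ cong (_*_ (ε ^ k′)) (±1^[2k]≡1 ε≡±1 k) ⟨
  ε ^ k′ * ε ^ (2 ℕ.* k)        ≡⟨ ^-distribˡ-+-* ε k′ (2 ℕ.* k) ⟨
  ε ^ (k′ ℕ.+ 2 ℕ.* k)          ≡⟨ cong (ε ^_) exponent ⟩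
  ε ^ (k ℕ.+ 2 ℕ.* h)           ≡⟨ ^-distribˡ-+-* ε k (2 ℕ.* h) ⟩
  ε ^ k * ε ^ (2 ℕ.* h)         ≡⟨ cong (_*_ (ε ^ k)) (±1^[2k]≡1 ε≡±1 h) ⟩
  ε ^ k * + 1                   ≡⟨ *-identityʳ (ε ^ k) ⟩
  ε ^ k                         ∎
  where
  open ≡-Reasoning
  regroup : ∀ k k′ → k′ ℕ.+ 2 ℕ.* k ≡ k ℕ.+ (k ℕ.+ k′)
  regroup = ℕ-Solver.solve-∀
  exponent : k′ ℕ.+ 2 ℕ.* k ≡ k ℕ.+ 2 ℕ.* h
  exponent = trans (regroup k k′) (cong (k ℕ.+_) k+k′≡2h)

module OddPrimeModulus {h : ℕ} (p-prime : Prime (suc (2 ℕ.* h))) where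

  q : ℕ
  q = 2 ℕ.* h

  open PrimeModulus p-prime public
  open Congruence p public

  fermat : ∀ z → z ^ p ≈ z
  fermat (+ a)    = fermat-ℕ a
  fermat -[1+ n ] = ≈-trans (≡⇒≈ ([-x]^[1+2k]≡-x^[1+2k] (+ suc n) h)) (≈-neg (fermat-ℕ (suc n)))

  fermat-unit : ∀ z → ¬ (+ p ∣ z) → z ^ q ≈ + 1
  fermat-unit z p∤z = ≈-cancelˡ z p∤z (≈-trans (fermat z) (≡⇒≈ (sym (*-identityʳ z))))

  -- schröderCoeff q q is the Catalan number c with (2q+1) c = C(2q+1, q); modulo p we have
  -- 2q+1 ≡ -1 and, as q ≡ -1-p, 1 = C(q, q) ≡ (-1)^q C(p+q, q) = C(2q+1, q).
  catalan≈-1 : + schröderCoeff q q ≈ - + 1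
  catalan≈-1 = ≈-trans (≡⇒≈ (sym (neg-involutive (+ c)))) (≈-neg -c≈1)
    where
    open ≈-Reasoning
    c N : ℕ
    c = schröderCoeff q q
    N = suc (q ℕ.+ q)
    twice : ∀ n → n ℕ.+ suc (suc n) ≡ 2 ℕ.* suc n
    twice = ℕ-Solver.solve-∀
    twice′ : ∀ n → suc (n ℕ.+ n) ℕ.+ 1 ≡ 2 ℕ.* suc n
    twice′ = ℕ-Solver.solve-∀
    N≈-1 : + N ≈ - + 1
    N≈-1 = complement≈ 2 (twice′ q)
    NCq≈1 : + (N C q) ≈ + 1
    NCq≈1 = begin
      + (N C q)                       ≡⟨ *-identityˡ _ ⟨
      + 1 * + (N C q)
        ≡⟨ cong (_* + (N C q)) (trans ([-x]^[2k]≡x^[2k] (+ 1) h) (^-zeroˡ q)) ⟨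
      (- + 1) ^ q * + (N C q)         ≈⟨ ≈-sym (aCj≈[-1]ʲ*[b+j]Cj (complement≈ 2 (twice q)) q ℕP.≤-refl) ⟩
      + (q C q)                       ≡⟨ cong +_ (nCn≡1 q) ⟩
      + 1                             ∎
    -c≈1 : - + c ≈ + 1
    -c≈1 = begin
      - + c                           ≡⟨ -1*i≡-i (+ c) ⟨
      - + 1 * + c                     ≈⟨ ≈-* (≈-sym N≈-1) (≈-refl {+ c}) ⟩
      + N * + c                       ≡⟨ pos-* N c ⟨
      + (N ℕ.* c)                     ≡⟨ cong +_ ([1+2n]Cn≡[1+2n]*schröderCoeff[n,n] q) ⟨
      + (N C q)                       ≈⟨ NCq≈1 ⟩
      + 1                             ∎

module WeightedSums {h : ℕ} (p-prime : Prime (suc (2 ℕ.* h))) (p∤2 : ¬ (+ suc (2 ℕ.* h) ∣ + 2))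
                   {ε : ℤ} (ε≡±1 : ε ≡ + 1 ⊎ ε ≡ - + 1)
                   {z : ℤ} (p∤z : ¬ (+ suc (2 ℕ.* h) ∣ z)) (p∤z+1 : ¬ (+ suc (2 ℕ.* h) ∣ z + + 1))
                   (r : ℕ) where

  open OddPrimeModulus {h} p-prime

  m : ℕ
  m = 2 ℕ.* r ℕ.+ 1

  w : ℕ → ℤ
  w k = + (2 ℕ.* k ℕ.+ 1)

  largeTerm littleTerm : ℕ → ℤ
  largeTerm  k = w k ^ m * (ε ^ k * largeS k z)
  littleTerm k = w k ^ m * (ε ^ k * littleS k z)

  [-x]^m≡-x^m : ∀ x → (- x) ^ m ≡ - x ^ m
  [-x]^m≡-x^m x = subst (λ e → (- x) ^ e ≡ - x ^ e) (ℕP.+-comm 1 (2 ℕ.* r)) ([-x]^[1+2k]≡-x^[1+2k] x r)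

  w-reflect : ∀ {k k′} → suc (k ℕ.+ k′) ≡ p → w k′ ≈ - w k
  w-reflect {k} {k′} 1+k+k′≡p = divides-difference (Signed.divides (+ 2) (begin
    w k′ - - w k                                 ≡⟨ minus-neg (w k′) (w k) ⟩
    w k′ + w k                                   ≡⟨ pos-+ (2 ℕ.* k′ ℕ.+ 1) (2 ℕ.* k ℕ.+ 1) ⟨
    + (2 ℕ.* k′ ℕ.+ 1 ℕ.+ (2 ℕ.* k ℕ.+ 1))       ≡⟨ cong +_ (double k k′) ⟩
    + (2 ℕ.* suc (k ℕ.+ k′))                     ≡⟨ cong (λ n → + (2 ℕ.* n)) 1+k+k′≡p ⟩
    + (2 ℕ.* p)                                  ≡⟨ pos-* 2 p ⟩
    + 2 * + p                                    ∎))
    where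
    open ≡-Reasoning
    minus-neg : ∀ x y → x - - y ≡ x + y
    minus-neg = solve-∀
    double : ∀ k k′ → 2 ℕ.* k′ ℕ.+ 1 ℕ.+ (2 ℕ.* k ℕ.+ 1) ≡ 2 ℕ.* suc (k ℕ.+ k′)
    double = ℕ-Solver.solve-∀

  A : ℕ → ℤ
  A k = Σ< q (λ j → + schröderCoeff k j * z ^ j)

  largeS-split : ∀ {k} → k < p → largeS k z ≡ A k + + schröderCoeff k q * z ^ q
  largeS-split {k} (s≤s k≤q) = begin
    Σ< (suc k) G                   ≡⟨ Σ<-pad (suc k) (q ∸ k) G vanish ⟨
    Σ< (suc k ℕ.+ (q ∸ k)) G       ≡⟨ cong (λ n → Σ< (suc n) G) (ℕP.m+[n∸m]≡n k≤q) ⟩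
    Σ< (suc q) G                   ∎
    where
    open ≡-Reasoning
    G : ℕ → ℤ
    G j = + schröderCoeff k j * z ^ j
    vanish : ∀ i → G (suc k ℕ.+ i) ≡ + 0
    vanish i = cong (λ c → + c * z ^ (suc k ℕ.+ i)) (schröderCoeff-vanish (s≤s (ℕP.m≤m+n k i)))

  g : ℕ → ℤ
  g k = (w k ^ m * ε ^ k) * A k

  g-reflect : ∀ k → k < p → g (p ∸ suc k) ≈ - g k
  g-reflect k (s≤s k≤q) = begin
    (w k′ ^ m * ε ^ k′) * A k′
      ≈⟨ ≈-* (≈-* (≈-^ m (w-reflect {k} {k′} (cong suc k+k′≡q)))
                  (≡⇒≈ (±1^-reflect ε≡±1 {h} {k} {k′} k+k′≡q)))
             A-reflect ⟩
    ((- w k) ^ m * ε ^ k) * A k    ≡⟨ cong (λ t → (t * ε ^ k) * A k) ([-x]^m≡-x^m (w k)) ⟩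
    (- w k ^ m * ε ^ k) * A k      ≡⟨ pull-neg (w k ^ m) (ε ^ k) (A k) ⟩
    - g k                          ∎
    where
    open ≈-Reasoning
    k′ : ℕ
    k′ = q ∸ k
    k+k′≡q : k ℕ.+ k′ ≡ q
    k+k′≡q = ℕP.m+[n∸m]≡n k≤q
    A-reflect : A k′ ≈ A k
    A-reflect = Σ<-cong-≈ q (λ j j<q →
      ≈-* (schröderCoeff-reflect (cong suc (trans (ℕP.+-comm k′ k) k+k′≡q)) j (s≤s j<q)) (≈-refl {z ^ j}))
    pull-neg : ∀ a b c → (- a * b) * c ≡ - ((a * b) * c)
    pull-neg = solve-∀

  H : ℕ → ℤ
  H k = (w k ^ m * ε ^ k) * (+ schröderCoeff k q * z ^ q)

  H-vanish : ∀ k → k < q → H k ≡ + 0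
  H-vanish k k<q = trans (cong (λ c → (w k ^ m * ε ^ k) * (+ c * z ^ q)) (schröderCoeff-vanish k<q))
                         (*-zeroʳ (w k ^ m * ε ^ k))

  H-top≈1 : H q ≈ + 1
  H-top≈1 = begin
    (w q ^ m * ε ^ q) * (+ schröderCoeff q q * z ^ q)
      ≈⟨ ≈-* (≈-* (≈-^ m (w-reflect {0} refl)) (≡⇒≈ (±1^[2k]≡1 ε≡±1 h)))
             (≈-* catalan≈-1 (fermat-unit z p∤z)) ⟩
    ((- + 1) ^ m * + 1) * (- + 1 * + 1)
      ≡⟨ cong (λ t → (t * + 1) * (- + 1 * + 1)) (trans ([-x]^m≡-x^m (+ 1)) (cong -_ (^-zeroˡ m))) ⟩
    + 1 ∎
    where open ≈-Reasoning

  Σ-largeTerm≈1 : Σ< p largeTerm ≈ + 1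
  Σ-largeTerm≈1 = begin
    Σ< p largeTerm                     ≡⟨ Σ<-cong p split ⟩
    Σ< p (λ k → g k + H k)             ≡⟨ Σ<-distrib-+ p g H ⟩
    Σ< p g + (Σ< q H + H q)            ≈⟨ ≈-+ Σg≈0 (≈-+ (≡⇒≈ (Σ<-zero q H H-vanish)) H-top≈1) ⟩
    + 1                                ∎
    where
    open ≈-Reasoning
    expand : ∀ a b x y → a * (b * (x + y)) ≡ (a * b) * x + (a * b) * y
    expand = solve-∀
    split : ∀ k → k < p → largeTerm k ≡ g k + H k
    split k k<p = trans (cong (λ s → w k ^ m * (ε ^ k * s)) (largeS-split k<p))
                        (expand (w k ^ m) (ε ^ k) _ _)
    Σg≈0 : Σ< p g ≈ + 0
    Σg≈0 = ≈-cancelˡ (+ 2) p∤2 (Σ<-reflect-antisymmetric p g g-reflect)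

  Σ-largeTerm≡1+[z+1]*Σ-littleTerm : Σ< p largeTerm ≡ + 1 + (z + + 1) * Σ< p littleTerm
  Σ-largeTerm≡1+[z+1]*Σ-littleTerm = begin
    Σ< p largeTerm
      ≡⟨ Σ<-suc q largeTerm ⟩
    largeTerm 0 + Σ< q (λ k → largeTerm (suc k))
      ≡⟨ cong₂ _+_ largeTerm-0 (Σ<-cong q (λ k _ → factor k)) ⟩
    + 1 + Σ< q (λ k → (z + + 1) * littleTerm (suc k))
      ≡⟨ cong (_+_ (+ 1)) (Σ<-distribˡ-* q (z + + 1) _) ⟨
    + 1 + (z + + 1) * Σ< q (λ k → littleTerm (suc k))
      ≡⟨ cong (λ s → + 1 + (z + + 1) * s) Σ-littleTerm-shift ⟨
    + 1 + (z + + 1) * Σ< p littleTerm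
      ∎
    where
    open ≡-Reasoning
    largeTerm-0 : largeTerm 0 ≡ + 1
    largeTerm-0 = cong (_* + 1) (^-zeroˡ m)
    Σ-littleTerm-shift : Σ< p littleTerm ≡ Σ< q (λ k → littleTerm (suc k))
    Σ-littleTerm-shift = trans (Σ<-suc q littleTerm)
                               (trans (cong (_+ Σ< q (λ k → littleTerm (suc k))) (*-zeroʳ ((+ 1) ^ m)))
                                      (+-identityˡ _))
    commute : ∀ a b s t → a * (b * (s * t)) ≡ s * (a * (b * t))
    commute = solve-∀
    factor : ∀ k → largeTerm (suc k) ≡ (z + + 1) * littleTerm (suc k)
    factor k = trans (cong (λ s → w (suc k) ^ m * (ε ^ suc k * s)) (largeS≡[z+1]*littleS k z))
                     (commute (w (suc k) ^ m) (ε ^ suc k) (z + + 1) (littleS (suc k) z))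

  Σ-littleTerm≈0 : Σ< p littleTerm ≈ + 0
  Σ-littleTerm≈0 = ≈-cancelˡ (z + + 1) p∤z+1 (begin
    (z + + 1) * Σ< p littleTerm                   ≡⟨ isolate (z + + 1) (Σ< p littleTerm) ⟩
    (+ 1 + (z + + 1) * Σ< p littleTerm) - + 1     ≡⟨ cong (_- + 1) Σ-largeTerm≡1+[z+1]*Σ-littleTerm ⟨
    Σ< p largeTerm - + 1                          ≈⟨ ≈-+ Σ-largeTerm≈1 (≈-refl { - + 1}) ⟩
    + 1 - + 1                                     ≡⟨ *-zeroʳ (z + + 1) ⟨
    (z + + 1) * + 0                               ∎)
    where
    open ≈-Reasoning
    isolate : ∀ a s → a * s ≡ (+ 1 + a * s) - + 1
    isolate = solve-∀

even⊎odd : ∀ n → ∃[ h ] (n ≡ 2 ℕ.* h ⊎ n ≡ suc (2 ℕ.* h))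
even⊎odd zero = 0 , inj₁ refl
even⊎odd (suc n) with even⊎odd n
... | h , inj₁ refl = h , inj₂ refl
... | h , inj₂ refl = suc h , inj₁ (2+2h≡2[1+h] h)
  where
  2+2h≡2[1+h] : ∀ h → suc (suc (2 ℕ.* h)) ≡ 2 ℕ.* suc h
  2+2h≡2[1+h] = ℕ-Solver.solve-∀

odd-prime≡1+2h : ∀ {p} → Prime p → p ≢ 2 → ∃[ h ] p ≡ suc (2 ℕ.* h)
odd-prime≡1+2h {p} p-prime p≢2 with even⊎odd p
... | h , inj₂ p≡1+2h = h , p≡1+2h
... | h , inj₁ p≡2h with prime⇒irreducible p-prime (ℕ.divides h (trans p≡2h (ℕP.*-comm 2 h)))
...   | inj₁ ()
...   | inj₂ 2≡p = contradiction (sym 2≡p) p≢2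

odd-prime∤2 : ∀ {p} → Prime p → p ≢ 2 → ¬ (p ℕ.∣ 2)
odd-prime∤2 p-prime p≢2 p∣2 with irreducible[2] p∣2
... | inj₁ p≡1 = ℕ.nonTrivial⇒≢1 {{prime⇒nonTrivial p-prime}} p≡1
... | inj₂ p≡2 = p≢2 p≡2

prime∤factors-of-coprime : ∀ {p} → Prime p → ∀ {a b} → gcd (+ p) (a * b) ≡ + 1 →
                           ¬ (+ p ∣ a) × ¬ (+ p ∣ b)
prime∤factors-of-coprime {p} p-prime {a} {b} coprime =
  (λ p∣a → p∤ab (subst (p ℕ.∣_) (sym (abs-* a b)) (ℕ.∣m⇒∣m*n ℤ.∣ b ∣ p∣a))) ,
  (λ p∣b → p∤ab (subst (p ℕ.∣_) (sym (abs-* a b)) (ℕ.∣n⇒∣m*n ℤ.∣ a ∣ p∣b)))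
  where
  p∤ab : ¬ (+ p ∣ a * b)
  p∤ab p∣ab = ℕ.nonTrivial⇒≢1 {{prime⇒nonTrivial p-prime}}
                (ℕ.∣1⇒≡1 (subst (+ p ∣_) coprime (gcd-greatest {+ p} {a * b} {+ p} (ℕ.∣-refl {p}) p∣ab)))

theorem1p1 : (p : ℕ) → Prime p → p ≢ 2 → (ε : ℤ) → (ε ≡ + 1 ⊎ ε ≡ - + 1) → (z : ℤ) →
    gcd (+ p) (z * (z + + 1)) ≡ + 1 → (r : ℕ) →
    (+ p ∣ (Σ< p (λ k → (+ (2 ℕ.* k ℕ.+ 1)) ^ (2 ℕ.* r ℕ.+ 1) * (ε ^ k * largeS k z)) - + 1))
    × (+ p ∣ Σ< p (λ k → (+ (2 ℕ.* k ℕ.+ 1)) ^ (2 ℕ.* r ℕ.+ 1) * (ε ^ k * littleS k z)))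
theorem1p1 p p-prime p≢2 ε ε≡±1 z coprime r
  with odd-prime≡1+2h p-prime p≢2 | prime∤factors-of-coprime p-prime {z} {z + + 1} coprime
... | h , refl | p∤z , p∤z+1 =
  ≈⇒∣ Σ-largeTerm≈1 , subst (+ p ∣_) (+-identityʳ (Σ< p littleTerm)) (≈⇒∣ Σ-littleTerm≈0)
  where
  open WeightedSums {h} p-prime (odd-prime∤2 p-prime p≢2) ε≡±1 {z} p∤z p∤z+1 r
  open Congruence p
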